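{- Suppose $Y\subset X=W_w(n,q)$ is an $(r,s)$-$(n,w,q,\lambda)$-design. Let $s',r',t$ be nonnegative integers with $s'\le s$, $s'\le r'\le r$ and $t\le r-r'$. Then for every $\omega'=(\omega'_1,\ldots,\omega'_{s'})\in\overline F^{s'}$ and all subsets $\mathcal S'=\{i_1,\ldots,i_{s'}\}\subset\mathcal R'\subset N$ and $\mathcal T\subset N$ with $|\mathcal S'|=s'$, $|\mathcal R'|=r'$, $|\mathcal T|=t$ and $\mathcal R'\cap\mathcal T=\emptyset$, \[ |\{y\in Y\mid \mathcal R'\subset\overline y,\ y_{i_j}=\omega'_j\ (j=1,\ldots,s'),\ \mathcal T\cap\overline y=\emptyset\}|=(q-1)^{s-s'}\frac{\binom{n-r'-t}{w-r'}}{\binom{n-r}{w-r}}\lambda. \]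
   Context: Let $q\ge 2$, $n\ge1$, $0\le w\le n$ be integers, $F=\{0,1,\ldots,q-1\}$, $\overline F=F\setminus\{0\}$, $N=\{1,\ldots,n\}$. For $x\in F^n$, $\overline x=\{i\mid x_i\ne0\}$; $X=W_w(n,q)$ is the set of $x\in F^n$ with $|\overline x|=w$. For $Y\subset X$, subsets $\mathcal{S}=\{i_1<\cdots<i_s\}\subset\mathcal{R}\subset N$ and $\omega\in\overline F^s$, put $m_{\mathcal R,\mathcal S}(Y,\omega)=|\{y\in Y\mid\mathcal R\subset\overline y,\ y_{i_j}=\omega_j\ (j=1,\ldots,s)\}|$. For integers $0\le s\le r\le w$, a subset $Y\subset X$ is an $(r,s)$-$(n,w,q,\lambda)$-design if $m_{\mathcal R,\mathcal S}(Y,\omega)=\lambda$ for all $\omega\in\overline F^s$ and all $\mathcal S\subset\mathcal R\subset N$ with $|\mathcal S|=s$, $|\mathcal R|=r$. -}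

module Defs where

open import Data.Nat using (ℕ)
open import Data.Bool using (Bool; not; true; false)
import Data.Bool.Properties as BoolP
open import Data.Fin using (Fin; zero; suc; _<_; toℕ)
open import Data.Fin.Properties as FinP using (_≟_; all?)
open import Data.Fin.Subset using (Subset; _⊆_; _∩_; ⊥; ∣_∣; _∈_)
open import Data.Fin.Subset.Properties using (_⊆?_)
open import Data.Vec using (Vec; lookup; map)
open import Data.Vec.Properties using (≡-dec)
open import Data.List using (List; length; filter)
open import Data.Product using (_×_)
open import Relation.Nullary using (Dec; ¬_)
open import Relation.Nullary.Decidable using (_×-dec_)
open import Relation.Binary.PropositionalEquality using (_≡_)

-- Alphabet F = {0,...,q-1} is Fin q, the zero symbol is Fin.zero.
-- A word of length n over F is a vector in F^n.
Word : ℕ → ℕ → Set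
Word n q = Vec (Fin q) n

isNonzero : ∀ {q} → Fin q → Bool
isNonzero zero    = false
isNonzero (suc _) = true

support : ∀ {n q} → Word n q → Subset n
support x = map isNonzero x

inX : ∀ {n q} → ℕ → Word n q → Set
inX w x = ∣ support x ∣ ≡ w

Nonzero : ∀ {q} → Fin q → Set
Nonzero a = ¬ (toℕ a ≡ 0)

-- An s-element subset S = {i_1 < ... < i_s} of N is given by the strictly
-- increasing enumeration ι : Fin s → Fin n, ι j = i_{j+1}.
StrictlyIncreasing : ∀ {s n} → (Fin s → Fin n) → Set
StrictlyIncreasing {s} ι = ∀ (j k : Fin s) → j < k → ι j < ι k

ImageIn : ∀ {s n} → (Fin s → Fin n) → Subset n → Set
ImageIn {s} ι R = ∀ (j : Fin s) → ι j ∈ R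

Matches : ∀ {n q s} → Subset n → (Fin s → Fin n) → (Fin s → Fin q) → Word n q → Set
Matches R ι ω y = (R ⊆ support y) × (∀ j → lookup y (ι j) ≡ ω j)

matches? : ∀ {n q s} (R : Subset n) (ι : Fin s → Fin n) (ω : Fin s → Fin q)
           (y : Word n q) → Dec (Matches R ι ω y)
matches? R ι ω y = (R ⊆? support y) ×-dec all? (λ j → lookup y (ι j) ≟ ω j)

mRS : ∀ {n q s} → List (Word n q) → Subset n → (Fin s → Fin n) → (Fin s → Fin q) → ℕ
mRS Y R ι ω = length (filter (matches? R ι ω) Y)

MatchesAvoid : ∀ {n q s} → Subset n → (Fin s → Fin n) → (Fin s → Fin q) → Subset n
               → Word n q → Set
MatchesAvoid R ι ω T y = Matches R ι ω y × (T ∩ support y ≡ ⊥)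

matchesAvoid? : ∀ {n q s} (R : Subset n) (ι : Fin s → Fin n) (ω : Fin s → Fin q)
                (T : Subset n) (y : Word n q) → Dec (MatchesAvoid R ι ω T y)
matchesAvoid? R ι ω T y = matches? R ι ω y ×-dec ≡-dec BoolP._≟_ (T ∩ support y) ⊥

mRST : ∀ {n q s} → List (Word n q) → Subset n → (Fin s → Fin n) → (Fin s → Fin q)
       → Subset n → ℕ
mRST Y R ι ω T = length (filter (matchesAvoid? R ι ω T) Y)

-- Y is an (r,s)-(n,w,q,λ)-design (Y a subset of X, given as a duplicate-free list)
IsDesign : ∀ {n q} → (r s w lam : ℕ) → List (Word n q) → Set
IsDesign {n} {q} r s w lam Y =
  ∀ (ι : Fin s → Fin n) (R : Subset n) (ω : Fin s → Fin q) →
  StrictlyIncreasing ι → ImageIn ι R → ∣ R ∣ ≡ r → (∀ j → Nonzero (ω j)) →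
  mRS Y R ι ω ≡ lam

module Submission where

-- The count is reduced to the design condition in three steps.
-- (i) For a ∈ R outside S, the words counted by m_{R,S}(ω) split according to the value
-- y_a ∈ F̄, each part being a count with one more prescribed coordinate; hence
-- m_{R,S′}(ω′) = (q-1)^{s-s′} λ =: μ whenever |R| = r.
-- (ii) Double counting the pairs (y, a) with a ∉ R and R ∪ {a} ⊆ ȳ gives
-- (w - |R|) m_R = Σ_{a ∉ R} m_{R ∪ {a}}, and the absorption identity
-- (n+1) C(n,k) = (k+1) C(n+1,k+1) turns this into m_R C(n-r,w-r) = C(n-|R|,w-|R|) μ.
-- (iii) For a ∈ T, m(R, T∖{a}) = m(R, T) + m(R ∪ {a}, T∖{a}), and Pascal's rule closes
-- the induction on |T|.
-- All counts are multiplied by C(n-r,w-r) so that no division is needed.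

open import Defs
open import Data.Bool using (true; false; if_then_else_)
open import Data.Nat using (ℕ; zero; suc; _+_; _*_; _∸_; _^_; _≤_; _<_; s≤s; z≤n)
open import Data.Nat.Properties as ℕ using ()
open import Algebra.Properties.CommutativeSemigroup ℕ.+-commutativeSemigroup using (interchange)
open import Algebra.Properties.CommutativeSemigroup ℕ.*-commutativeSemigroup using (x∙yz≈y∙xz)
open import Data.Nat.Combinatorics using (_C_; nCk+nC[k+1]≡[n+1]C[k+1]; nC1≡n)
open import Data.Nat.Tactic.RingSolver using (solve-∀)
open import Data.Fin using (Fin; zero; suc; _<?_) renaming (_<_ to _<ᶠ_)
open import Data.Fin.Properties as Fin using (∀-cons; ¬∀⟶∃¬)
open import Data.Fin.Subset using (Subset; inside; outside; ∣_∣; _⊆_; ⊤; ⊥; ⁅_⁆; _∩_; _∈_; _∉_; Nonempty)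
open import Data.Fin.Subset.Properties
  using ( _∈?_; drop-there; drop-∷-⊆; ∈⊤; ∣⊤∣≡n; ⊥⊆; ∉⊥; ∣⊥∣≡0; ∣⁅x⁆∣≡1; x∈⁅y⁆⇔x≡y
        ; x∈p∩q⁺; x∈p∩q⁻; Empty-unique; p⊆q⇒∣p∣≤∣q∣)
open import Data.Vec using ([]; _∷_; here; there; lookup; _[_]≔_)
open import Data.Vec.Properties using ([]≔-updates; []≔-minimal)
open import Data.Vec.Functional using () renaming (_∷_ to _◂_)
open import Data.List using (List; []; _∷_; length; filter)
open import Data.List.Membership.Propositional using () renaming (_∈_ to _∈ᴸ_)
import Data.List.Relation.Unary.Any as Any
open import Data.List.Relation.Unary.All as All using (All)
open import Data.List.Relation.Unary.Unique.Propositional using (Unique)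
open import Data.Product using (∃; _×_; _,_; proj₁; proj₂)
open import Data.Sum using (_⊎_; inj₁; inj₂; [_,_])
open import Function using (_∘_; _⇔_; mk⇔; Equivalence)
open import Level using (0ℓ)
open import Relation.Nullary using (Dec; yes; no; does; ¬_; contradiction)
open import Relation.Nullary.Decidable using (_→-dec_)
open import Relation.Unary using (Pred; Decidable)
open import Relation.Binary.PropositionalEquality
  using (_≡_; _≢_; refl; sym; trans; cong; cong₂; subst; subst₂; module ≡-Reasoning)

-- Defined through 'does', so that it computes under 'Dec.map′' and '_×-dec_'.
𝟙 : ∀ {p} {P : Set p} → Dec P → ℕ
𝟙 d = if does d then 1 else 0

𝟙-yes : ∀ {p} {P : Set p} (d : Dec P) → P → 𝟙 d ≡ 1
𝟙-yes (yes _) _ = refl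
𝟙-yes (no ¬p) p = contradiction p ¬p

𝟙-no : ∀ {p} {P : Set p} (d : Dec P) → ¬ P → 𝟙 d ≡ 0
𝟙-no (yes p) ¬p = contradiction p ¬p
𝟙-no (no _) _ = refl

𝟙-cong : ∀ {p q} {P : Set p} {Q : Set q} (d : Dec P) (e : Dec Q) → P ⇔ Q → 𝟙 d ≡ 𝟙 e
𝟙-cong (yes p) e P⇔Q = sym (𝟙-yes e (Equivalence.to P⇔Q p))
𝟙-cong (no ¬p) e P⇔Q = sym (𝟙-no e (¬p ∘ Equivalence.from P⇔Q))

length-filter-∷ : ∀ {A : Set} {P : Pred A 0ℓ} (P? : Decidable P) y Y →
  length (filter P? (y ∷ Y)) ≡ 𝟙 (P? y) + length (filter P? Y)
length-filter-∷ P? y Y with does (P? y)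
... | true  = refl
... | false = refl

module _ {A : Set} {P Q : Pred A 0ℓ} (P? : Decidable P) (Q? : Decidable Q) where

  length-filter-cong : ∀ Y → (∀ y → P y ⇔ Q y) → length (filter P? Y) ≡ length (filter Q? Y)
  length-filter-cong [] P⇔Q = refl
  length-filter-cong (y ∷ Y) P⇔Q = begin
    length (filter P? (y ∷ Y))          ≡⟨ length-filter-∷ P? y Y ⟩
    𝟙 (P? y) + length (filter P? Y)     ≡⟨ cong₂ _+_ (𝟙-cong (P? y) (Q? y) (P⇔Q y)) (length-filter-cong Y P⇔Q) ⟩
    𝟙 (Q? y) + length (filter Q? Y)     ≡⟨ length-filter-∷ Q? y Y ⟨
    length (filter Q? (y ∷ Y))          ∎
    where open ≡-Reasoning

  length-filter-+ : ∀ {R : Pred A 0ℓ} (R? : Decidable R) Y → (∀ y → 𝟙 (P? y) ≡ 𝟙 (Q? y) + 𝟙 (R? y)) →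
    length (filter P? Y) ≡ length (filter Q? Y) + length (filter R? Y)
  length-filter-+ R? [] split = refl
  length-filter-+ R? (y ∷ Y) split = begin
    length (filter P? (y ∷ Y))                                     ≡⟨ length-filter-∷ P? y Y ⟩
    𝟙 (P? y) + length (filter P? Y)                                ≡⟨ cong₂ _+_ (split y) (length-filter-+ R? Y split) ⟩
    (𝟙 (Q? y) + 𝟙 (R? y)) + (length (filter Q? Y) + length (filter R? Y))
                                                                   ≡⟨ interchange (𝟙 (Q? y)) (𝟙 (R? y)) _ _ ⟩
    (𝟙 (Q? y) + length (filter Q? Y)) + (𝟙 (R? y) + length (filter R? Y))
                                                                   ≡⟨ cong₂ _+_ (length-filter-∷ Q? y Y) (length-filter-∷ R? y Y) ⟨
    length (filter Q? (y ∷ Y)) + length (filter R? (y ∷ Y))        ∎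
    where open ≡-Reasoning

∑∉ : ∀ {n} → Subset n → (Fin n → ℕ) → ℕ
∑∉ [] f = 0
∑∉ (inside ∷ R) f = ∑∉ R (f ∘ suc)
∑∉ (outside ∷ R) f = f zero + ∑∉ R (f ∘ suc)

∑∉-cong : ∀ {n} (R : Subset n) {f g : Fin n → ℕ} → (∀ {a} → a ∉ R → f a ≡ g a) → ∑∉ R f ≡ ∑∉ R g
∑∉-cong [] f≡g = refl
∑∉-cong (inside ∷ R) f≡g = ∑∉-cong R (λ a∉R → f≡g (a∉R ∘ drop-there))
∑∉-cong (outside ∷ R) f≡g = cong₂ _+_ (f≡g λ ()) (∑∉-cong R (λ a∉R → f≡g (a∉R ∘ drop-there)))

∑∉-+ : ∀ {n} (R : Subset n) (f g : Fin n → ℕ) → ∑∉ R (λ a → f a + g a) ≡ ∑∉ R f + ∑∉ R g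
∑∉-+ [] f g = refl
∑∉-+ (inside ∷ R) f g = ∑∉-+ R (f ∘ suc) (g ∘ suc)
∑∉-+ (outside ∷ R) f g = trans (cong (f zero + g zero +_) (∑∉-+ R (f ∘ suc) (g ∘ suc)))
  (interchange (f zero) (g zero) (∑∉ R (f ∘ suc)) (∑∉ R (g ∘ suc)))

∑∉-*ʳ : ∀ {n} (R : Subset n) (f : Fin n → ℕ) c → ∑∉ R (λ a → f a * c) ≡ ∑∉ R f * c
∑∉-*ʳ [] f c = refl
∑∉-*ʳ (inside ∷ R) f c = ∑∉-*ʳ R (f ∘ suc) c
∑∉-*ʳ (outside ∷ R) f c = trans (cong (f zero * c +_) (∑∉-*ʳ R (f ∘ suc) c)) (sym (ℕ.*-distribʳ-+ c (f zero) _))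

∑∉-𝟙∈+∣∣ : ∀ {n} {R S : Subset n} → R ⊆ S → ∑∉ R (λ a → 𝟙 (a ∈? S)) + ∣ R ∣ ≡ ∣ S ∣
∑∉-𝟙∈+∣∣ {R = []} {[]} R⊆S = refl
∑∉-𝟙∈+∣∣ {R = inside ∷ R} {inside ∷ S} R⊆S = trans (ℕ.+-suc _ _) (cong suc (∑∉-𝟙∈+∣∣ (drop-∷-⊆ R⊆S)))
∑∉-𝟙∈+∣∣ {R = inside ∷ R} {outside ∷ S} R⊆S with () ← R⊆S here
∑∉-𝟙∈+∣∣ {R = outside ∷ R} {inside ∷ S} R⊆S = cong suc (∑∉-𝟙∈+∣∣ (drop-∷-⊆ R⊆S))
∑∉-𝟙∈+∣∣ {R = outside ∷ R} {outside ∷ S} R⊆S = ∑∉-𝟙∈+∣∣ (drop-∷-⊆ R⊆S)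

∑∉-𝟙∈ : ∀ {n} {R S : Subset n} → R ⊆ S → ∑∉ R (λ a → 𝟙 (a ∈? S)) ≡ ∣ S ∣ ∸ ∣ R ∣
∑∉-𝟙∈ {R = R} R⊆S = trans (sym (ℕ.m+n∸n≡m _ ∣ R ∣)) (cong (_∸ ∣ R ∣) (∑∉-𝟙∈+∣∣ R⊆S))

∑∉-const : ∀ {n} (R : Subset n) {f : Fin n → ℕ} {c} → (∀ {a} → a ∉ R → f a ≡ c) → ∑∉ R f ≡ (n ∸ ∣ R ∣) * c
∑∉-const {n} R {f} {c} f≡c = begin
  ∑∉ R f                            ≡⟨ ∑∉-cong R (λ {a} a∉R → trans (f≡c a∉R) (sym (1*c≡c a))) ⟩
  ∑∉ R (λ a → 𝟙 (a ∈? ⊤) * c)       ≡⟨ ∑∉-*ʳ R _ c ⟩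
  ∑∉ R (λ a → 𝟙 (a ∈? ⊤)) * c       ≡⟨ cong (_* c) (∑∉-𝟙∈ {R = R} {⊤} (λ _ → ∈⊤)) ⟩
  (∣ ⊤ {n} ∣ ∸ ∣ R ∣) * c               ≡⟨ cong (λ m → (m ∸ ∣ R ∣) * c) (∣⊤∣≡n n) ⟩
  (n ∸ ∣ R ∣) * c                    ∎
  where
  open ≡-Reasoning
  1*c≡c : ∀ a → 𝟙 (a ∈? ⊤) * c ≡ c
  1*c≡c a = trans (cong (_* c) (𝟙-yes (a ∈? ⊤) ∈⊤)) (ℕ.*-identityˡ c)

∑∉-0 : ∀ {n} (R : Subset n) {f : Fin n → ℕ} → (∀ {a} → a ∉ R → f a ≡ 0) → ∑∉ R f ≡ 0
∑∉-0 {n} R f≡0 = trans (∑∉-const R f≡0) (ℕ.*-zeroʳ (n ∸ ∣ R ∣))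

double-counting : ∀ {A : Set} {m} (R : Subset m) {P : Fin m → Pred A 0ℓ} {Q : Pred A 0ℓ}
  (P? : ∀ u → Decidable (P u)) (Q? : Decidable Q) (c : ℕ) (Y : List A) →
  (∀ {y} → y ∈ᴸ Y → ∑∉ R (λ u → 𝟙 (P? u y)) ≡ 𝟙 (Q? y) * c) →
  ∑∉ R (λ u → length (filter (P? u) Y)) ≡ length (filter Q? Y) * c
double-counting R P? Q? c [] fibre = ∑∉-0 R (λ _ → refl)
double-counting R P? Q? c (y ∷ Y) fibre = begin
  ∑∉ R (λ u → length (filter (P? u) (y ∷ Y)))
    ≡⟨ ∑∉-cong R (λ {u} _ → length-filter-∷ (P? u) y Y) ⟩
  ∑∉ R (λ u → 𝟙 (P? u y) + length (filter (P? u) Y))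
    ≡⟨ ∑∉-+ R _ _ ⟩
  ∑∉ R (λ u → 𝟙 (P? u y)) + ∑∉ R (λ u → length (filter (P? u) Y))
    ≡⟨ cong₂ _+_ (fibre (Any.here refl)) (double-counting R P? Q? c Y (fibre ∘ Any.there)) ⟩
  𝟙 (Q? y) * c + length (filter Q? Y) * c
    ≡⟨ ℕ.*-distribʳ-+ c (𝟙 (Q? y)) _ ⟨
  (𝟙 (Q? y) + length (filter Q? Y)) * c
    ≡⟨ cong (_* c) (length-filter-∷ Q? y Y) ⟨
  length (filter Q? (y ∷ Y)) * c
    ∎
  where open ≡-Reasoning

∈-insert⁺ : ∀ {n} (p : Subset n) {x y} → y ∈ p → y ∈ p [ x ]≔ inside
∈-insert⁺ p {x} {y} y∈p with y Fin.≟ x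
... | yes refl = []≔-updates p x
... | no y≢x = []≔-minimal p y x y≢x y∈p

∈-update⁻ : ∀ {n} (p : Subset n) {x y b} → y ∈ p [ x ]≔ b → (y ≡ x × b ≡ inside) ⊎ y ∈ p
∈-update⁻ (_ ∷ p) {zero} here = inj₁ (refl , refl)
∈-update⁻ (_ ∷ p) {zero} (there y∈p) = inj₂ (there y∈p)
∈-update⁻ (_ ∷ p) {suc x} here = inj₂ here
∈-update⁻ (_ ∷ p) {suc x} (there y∈p) with ∈-update⁻ p y∈p
... | inj₁ (refl , b≡inside) = inj₁ (refl , b≡inside)
... | inj₂ y∈p′ = inj₂ (there y∈p′)

∉-remove : ∀ {n} (p : Subset n) x → x ∉ p [ x ]≔ outside
∉-remove (_ ∷ p) zero ()
∉-remove (_ ∷ p) (suc x) (there x∈) = ∉-remove p x x∈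

∈-remove⁻ : ∀ {n} (p : Subset n) {x y} → y ∈ p [ x ]≔ outside → y ∈ p
∈-remove⁻ p y∈p⁻ with ∈-update⁻ p y∈p⁻
... | inj₁ (_ , ())
... | inj₂ y∈p = y∈p

∣p[x]≔inside∣≡1+∣p∣ : ∀ {n} (p : Subset n) {x} → x ∉ p → ∣ p [ x ]≔ inside ∣ ≡ suc ∣ p ∣
∣p[x]≔inside∣≡1+∣p∣ (inside ∷ p) {zero} x∉p = contradiction here x∉p
∣p[x]≔inside∣≡1+∣p∣ (outside ∷ p) {zero} x∉p = refl
∣p[x]≔inside∣≡1+∣p∣ (inside ∷ p) {suc x} x∉p = cong suc (∣p[x]≔inside∣≡1+∣p∣ p (x∉p ∘ there))
∣p[x]≔inside∣≡1+∣p∣ (outside ∷ p) {suc x} x∉p = ∣p[x]≔inside∣≡1+∣p∣ p (x∉p ∘ there)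

1+∣p[x]≔outside∣≡∣p∣ : ∀ {n} (p : Subset n) {x} → x ∈ p → suc ∣ p [ x ]≔ outside ∣ ≡ ∣ p ∣
1+∣p[x]≔outside∣≡∣p∣ (inside ∷ p) here = refl
1+∣p[x]≔outside∣≡∣p∣ (inside ∷ p) (there x∈p) = cong suc (1+∣p[x]≔outside∣≡∣p∣ p x∈p)
1+∣p[x]≔outside∣≡∣p∣ (outside ∷ p) (there x∈p) = 1+∣p[x]≔outside∣≡∣p∣ p x∈p

∣p[x]≔inside∣≤1+∣p∣ : ∀ {n} (p : Subset n) x → ∣ p [ x ]≔ inside ∣ ≤ suc ∣ p ∣
∣p[x]≔inside∣≤1+∣p∣ (inside ∷ p) zero = ℕ.n≤1+n _
∣p[x]≔inside∣≤1+∣p∣ (outside ∷ p) zero = ℕ.≤-refl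
∣p[x]≔inside∣≤1+∣p∣ (inside ∷ p) (suc x) = s≤s (∣p[x]≔inside∣≤1+∣p∣ p x)
∣p[x]≔inside∣≤1+∣p∣ (outside ∷ p) (suc x) = ∣p[x]≔inside∣≤1+∣p∣ p x

∣p∣≡0⇒x∉p : ∀ {n} {p : Subset n} {x} → ∣ p ∣ ≡ 0 → x ∉ p
∣p∣≡0⇒x∉p {p = outside ∷ p} ∣p∣≡0 (there x∈p) = ∣p∣≡0⇒x∉p ∣p∣≡0 x∈p

∣p∣≡1+n⇒Nonempty : ∀ {n} {p : Subset n} {t} → ∣ p ∣ ≡ suc t → Nonempty p
∣p∣≡1+n⇒Nonempty {p = inside ∷ p} _ = zero , here
∣p∣≡1+n⇒Nonempty {p = outside ∷ p} ∣p∣≡1+t with x , x∈p ← ∣p∣≡1+n⇒Nonempty ∣p∣≡1+t = suc x , there x∈p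

p∩q≡⊥⇒x∈p⇒x∉q : ∀ {n} {p q : Subset n} {x} → p ∩ q ≡ ⊥ → x ∈ p → x ∉ q
p∩q≡⊥⇒x∈p⇒x∉q p∩q≡⊥ x∈p x∈q = ∉⊥ (subst (_ ∈_) p∩q≡⊥ (x∈p∩q⁺ (x∈p , x∈q)))

x∈p⇒x∉q⇒p∩q≡⊥ : ∀ {n} {p q : Subset n} → (∀ {x} → x ∈ p → x ∉ q) → p ∩ q ≡ ⊥
x∈p⇒x∉q⇒p∩q≡⊥ {p = p} {q} disjoint =
  Empty-unique λ { (x , x∈p∩q) → let x∈p , x∈q = x∈p∩q⁻ p q x∈p∩q in disjoint x∈p x∈q }

p[x]≔outside∩q≡⊥⇔p∩q≡⊥ : ∀ {n} (p q : Subset n) {x} → x ∉ q → (p [ x ]≔ outside) ∩ q ≡ ⊥ ⇔ p ∩ q ≡ ⊥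
p[x]≔outside∩q≡⊥⇔p∩q≡⊥ p q {x} x∉q = mk⇔
  (λ p⁻∩q≡⊥ → x∈p⇒x∉q⇒p∩q≡⊥ λ y∈p y∈q → p∩q≡⊥⇒x∈p⇒x∉q p⁻∩q≡⊥ (∈-remove⁺ y∈p y∈q) y∈q)
  (λ p∩q≡⊥ → x∈p⇒x∉q⇒p∩q≡⊥ λ y∈p⁻ → p∩q≡⊥⇒x∈p⇒x∉q p∩q≡⊥ (∈-remove⁻ p y∈p⁻))
  where
  ∈-remove⁺ : ∀ {y} → y ∈ p → y ∈ q → y ∈ p [ x ]≔ outside
  ∈-remove⁺ {y} y∈p y∈q = []≔-minimal p y x (λ { refl → x∉q y∈q }) y∈p

p∩q≡⊥⇒p∩q[x]≔outside≡⊥ : ∀ {n} {p} (q : Subset n) {x} → p ∩ q ≡ ⊥ → p ∩ (q [ x ]≔ outside) ≡ ⊥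
p∩q≡⊥⇒p∩q[x]≔outside≡⊥ q p∩q≡⊥ =
  x∈p⇒x∉q⇒p∩q≡⊥ λ y∈p y∈q⁻ → p∩q≡⊥⇒x∈p⇒x∉q p∩q≡⊥ y∈p (∈-remove⁻ q y∈q⁻)

p∩q≡⊥⇒p[x]≔inside∩q[x]≔outside≡⊥ : ∀ {n} (p q : Subset n) {x} → p ∩ q ≡ ⊥ →
  (p [ x ]≔ inside) ∩ (q [ x ]≔ outside) ≡ ⊥
p∩q≡⊥⇒p[x]≔inside∩q[x]≔outside≡⊥ p q {x} p∩q≡⊥ = x∈p⇒x∉q⇒p∩q≡⊥ λ y∈p⁺ →
  [ (λ { (refl , _) → ∉-remove q x }) , p∩q≡⊥⇒x∈p⇒x∉q (p∩q≡⊥⇒p∩q[x]≔outside≡⊥ q p∩q≡⊥) ]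
    (∈-update⁻ p y∈p⁺)

image : ∀ {s n} → (Fin s → Fin n) → Subset n
image {zero} ι = ⊥
image {suc s} ι = image (ι ∘ suc) [ ι zero ]≔ inside

∣image∣≤ : ∀ {s n} (ι : Fin s → Fin n) → ∣ image ι ∣ ≤ s
∣image∣≤ {zero} {n} ι = ℕ.≤-reflexive (∣⊥∣≡0 n)
∣image∣≤ {suc s} ι = ℕ.≤-trans (∣p[x]≔inside∣≤1+∣p∣ (image (ι ∘ suc)) (ι zero)) (s≤s (∣image∣≤ (ι ∘ suc)))

∈-image : ∀ {s n} (ι : Fin s → Fin n) j → ι j ∈ image ι
∈-image {suc s} ι zero = []≔-updates (image (ι ∘ suc)) (ι zero)
∈-image {suc s} ι (suc j) = ∈-insert⁺ (image (ι ∘ suc)) (∈-image (ι ∘ suc) j)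

∃-outside-image : ∀ {s n} (ι : Fin s → Fin n) (R : Subset n) → s < ∣ R ∣ →
  ∃ λ a → a ∈ R × (∀ j → ι j ≢ a)
∃-outside-image {s} {n} ι R s<∣R∣
  with a , a∈R⇏a∈ι ← ¬∀⟶∃¬ n _ (λ a → a ∈? R →-dec a ∈? image ι)
           (λ R⊆image → ℕ.<⇒≱ s<∣R∣ (ℕ.≤-trans (p⊆q⇒∣p∣≤∣q∣ (R⊆image _)) (∣image∣≤ ι)))
  with a ∈? R
... | no a∉R = contradiction (λ a∈R → contradiction a∈R a∉R) a∈R⇏a∈ι
... | yes a∈R = a , a∈R , λ { j refl → a∈R⇏a∈ι (λ _ → ∈-image ι j) }

module Insertion {A : Set} {n : ℕ} (key : A → Fin n) where

  insert : ∀ {s} → (Fin s → A) → A → Fin (suc s) → A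
  insert {zero} f x = λ _ → x
  insert {suc s} f x with key x <? key (f zero)
  ... | yes _ = x ◂ f
  ... | no _ = f zero ◂ insert (f ∘ suc) x

  ∀-insert⁺ : ∀ {s} (Q : A → Set) (f : Fin s → A) {x} → Q x → (∀ k → Q (f k)) → ∀ j → Q (insert f x j)
  ∀-insert⁺ {zero} Q f Qx Qf j = Qx
  ∀-insert⁺ {suc s} Q f {x} Qx Qf with key x <? key (f zero)
  ... | yes _ = ∀-cons Qx Qf
  ... | no _ = ∀-cons (Qf zero) (∀-insert⁺ Q (f ∘ suc) Qx (Qf ∘ suc))

  ∀-insert⁻ : ∀ {s} (Q : A → Set) (f : Fin s → A) {x} → (∀ j → Q (insert f x j)) → Q x × (∀ k → Q (f k))
  ∀-insert⁻ {zero} Q f Qins = Qins zero , λ ()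
  ∀-insert⁻ {suc s} Q f {x} Qins with key x <? key (f zero)
  ... | yes _ = Qins zero , Qins ∘ suc
  ... | no _ with Qx , Qf ← ∀-insert⁻ Q (f ∘ suc) (Qins ∘ suc) = Qx , ∀-cons (Qins zero) Qf

  strictlyIncreasing-◂ : ∀ {s} {x} {f : Fin s → A} → (∀ k → key x <ᶠ key (f k)) → StrictlyIncreasing (key ∘ f) →
    StrictlyIncreasing (key ∘ (x ◂ f))
  strictlyIncreasing-◂ x<f f↑ zero (suc k) _ = x<f k
  strictlyIncreasing-◂ x<f f↑ (suc j) (suc k) (s≤s j<k) = f↑ j k j<k

  strictlyIncreasing-insert : ∀ {s} (f : Fin s → A) x → StrictlyIncreasing (key ∘ f) → (∀ k → key (f k) ≢ key x) →
    StrictlyIncreasing (key ∘ insert f x)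
  strictlyIncreasing-insert {zero} f x f↑ f≢x zero zero ()
  strictlyIncreasing-insert {suc s} f x f↑ f≢x with key x <? key (f zero)
  ... | yes x<f₀ = strictlyIncreasing-◂ (∀-cons x<f₀ λ k → ℕ.<-trans x<f₀ (f↑ zero (suc k) (s≤s z≤n))) f↑
  ... | no x≮f₀ = strictlyIncreasing-◂
          (∀-insert⁺ (λ y → key (f zero) <ᶠ key y) (f ∘ suc) f₀<x (λ k → f↑ zero (suc k) (s≤s z≤n)))
          (strictlyIncreasing-insert (f ∘ suc) x (λ j k j<k → f↑ (suc j) (suc k) (s≤s j<k)) (f≢x ∘ suc))
    where
    f₀<x : key (f zero) <ᶠ key x
    f₀<x = ℕ.≤∧≢⇒< (ℕ.≮⇒≥ x≮f₀) (f≢x zero ∘ Fin.toℕ-injective)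

m∸[1+n]∸o≡m∸n∸[1+o] : ∀ m n o → m ∸ suc n ∸ o ≡ m ∸ n ∸ suc o
m∸[1+n]∸o≡m∸n∸[1+o] m n o = begin
  m ∸ suc n ∸ o    ≡⟨ ℕ.∸-+-assoc m (suc n) o ⟩
  m ∸ (suc n + o)  ≡⟨ cong (m ∸_) (ℕ.+-suc n o) ⟨
  m ∸ (n + suc o)  ≡⟨ ℕ.∸-+-assoc m n (suc o) ⟨
  m ∸ n ∸ suc o    ∎
  where open ≡-Reasoning

[1+n]*nCk≡[1+k]*[1+n]C[1+k] : ∀ n k → suc n * (n C k) ≡ suc k * (suc n C suc k)
[1+n]*nCk≡[1+k]*[1+n]C[1+k] zero zero = refl
[1+n]*nCk≡[1+k]*[1+n]C[1+k] zero (suc k) = sym (ℕ.*-zeroʳ (suc (suc k)))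
[1+n]*nCk≡[1+k]*[1+n]C[1+k] (suc n) zero = trans (ℕ.*-identityʳ (suc (suc n))) (sym (trans (ℕ.+-identityʳ _) (nC1≡n (suc (suc n)))))
[1+n]*nCk≡[1+k]*[1+n]C[1+k] (suc n) (suc k) = begin
  suc (suc n) * (suc n C suc k)                       ≡⟨ cong (suc (suc n) *_) pascal₁ ⟨
  suc (suc n) * (a + b)                               ≡⟨ expand n a b ⟩
  (a + b) + (suc n * a + suc n * b)                    ≡⟨ cong ((a + b) +_) (cong₂ _+_ IH₁ IH₂) ⟩
  (a + b) + (suc k * (a + b) + suc (suc k) * c)        ≡⟨ collect k (a + b) c ⟩
  suc (suc k) * ((a + b) + c)                          ≡⟨ cong (suc (suc k) *_) (trans (cong (_+ c) pascal₁) pascal₂) ⟩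
  suc (suc k) * (suc (suc n) C suc (suc k))            ∎
  where
  open ≡-Reasoning
  a b c : ℕ
  a = n C k
  b = n C suc k
  c = suc n C suc (suc k)
  pascal₁ : a + b ≡ suc n C suc k
  pascal₁ = nCk+nC[k+1]≡[n+1]C[k+1] n k
  pascal₂ : suc n C suc k + c ≡ suc (suc n) C suc (suc k)
  pascal₂ = nCk+nC[k+1]≡[n+1]C[k+1] (suc n) (suc k)
  IH₁ : suc n * a ≡ suc k * (a + b)
  IH₁ = trans ([1+n]*nCk≡[1+k]*[1+n]C[1+k] n k) (cong (suc k *_) (sym pascal₁))
  IH₂ : suc n * b ≡ suc (suc k) * c
  IH₂ = [1+n]*nCk≡[1+k]*[1+n]C[1+k] n (suc k)
  expand : ∀ n a b → suc (suc n) * (a + b) ≡ (a + b) + (suc n * a + suc n * b)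
  expand = solve-∀
  collect : ∀ k a c → a + (suc k * a + suc (suc k) * c) ≡ suc (suc k) * (a + c)
  collect = solve-∀

∈-support⁻ : ∀ {n q} (y : Word n (suc q)) {i} → i ∈ support y → ∃ λ v → lookup y i ≡ suc v
∈-support⁻ (suc v ∷ y) here = v , refl
∈-support⁻ (_ ∷ y) (there i∈y) = ∈-support⁻ y i∈y

module _ {n q s : ℕ} {ι : Fin s → Fin n} {ω : Fin s → Fin q} {y : Word n q} where

  Matches-insert : ∀ (R : Subset n) a → Matches (R [ a ]≔ inside) ι ω y ⇔ (Matches R ι ω y × a ∈ support y)
  Matches-insert R a = mk⇔
    (λ (R⁺⊆y , y≡ω) → ((R⁺⊆y ∘ ∈-insert⁺ R) , y≡ω) , R⁺⊆y ([]≔-updates R a))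
    (λ ((R⊆y , y≡ω) , a∈y) → (λ x∈R⁺ → [ (λ { (refl , _) → a∈y }) , R⊆y ] (∈-update⁻ R x∈R⁺)) , y≡ω)

module Extension {n q₀ s : ℕ} (ι : Fin s → Fin n) (ω : Fin s → Fin (suc q₀)) (a : Fin n) where
  open Insertion {Fin n × Fin (suc q₀)} proj₁ public

  -- The nonzero symbols are the suc u with u : Fin q₀; 'extended u' also prescribes y_a = suc u.
  extended : Fin q₀ → Fin (suc s) → Fin n × Fin (suc q₀)
  extended u = insert (λ j → ι j , ω j) (a , suc u)

  ιᵘ : Fin q₀ → Fin (suc s) → Fin n
  ιᵘ u = proj₁ ∘ extended u

  ωᵘ : Fin q₀ → Fin (suc s) → Fin (suc q₀)
  ωᵘ u = proj₂ ∘ extended u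

  Matches-extended : ∀ R u (y : Word n (suc q₀)) → Matches R (ιᵘ u) (ωᵘ u) y ⇔ (Matches R ι ω y × lookup y a ≡ suc u)
  Matches-extended R u y = mk⇔
    (λ (R⊆y , y≡ωᵘ) → let y≡u , y≡ω = ∀-insert⁻ Q _ y≡ωᵘ in (R⊆y , y≡ω) , y≡u)
    (λ ((R⊆y , y≡ω) , y≡u) → R⊆y , ∀-insert⁺ Q _ y≡u y≡ω)
    where
    Q : Fin n × Fin (suc q₀) → Set
    Q (i , v) = lookup y i ≡ v

  ∑∉⊥-𝟙Matches-extended : ∀ {R} → a ∈ R → (y : Word n (suc q₀)) (match? : Dec (Matches R ι ω y)) →
    ∑∉ ⊥ (λ u → 𝟙 (matches? R (ιᵘ u) (ωᵘ u) y)) ≡ 𝟙 match? * 1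
  ∑∉⊥-𝟙Matches-extended {R} a∈R y (no ¬match) = ∑∉-0 ⊥ λ {u} _ →
    𝟙-no (matches? R (ιᵘ u) (ωᵘ u) y) (¬match ∘ proj₁ ∘ Equivalence.to (Matches-extended R u y))
  ∑∉⊥-𝟙Matches-extended {R} a∈R y (yes match@(R⊆y , _)) with v , y≡v ← ∈-support⁻ y (R⊆y a∈R) = begin
    ∑∉ ⊥ (λ u → 𝟙 (matches? R (ιᵘ u) (ωᵘ u) y))
      ≡⟨ ∑∉-cong ⊥ (λ {u} _ → 𝟙-cong (matches? R (ιᵘ u) (ωᵘ u) y) (u ∈? ⁅ v ⁆) (matches⇔u∈⁅v⁆ u)) ⟩
    ∑∉ ⊥ (λ u → 𝟙 (u ∈? ⁅ v ⁆))
      ≡⟨ ∑∉-𝟙∈ {R = ⊥} {⁅ v ⁆} ⊥⊆ ⟩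
    ∣ ⁅ v ⁆ ∣ ∸ ∣ ⊥ {q₀} ∣
      ≡⟨ cong₂ _∸_ (∣⁅x⁆∣≡1 v) (∣⊥∣≡0 q₀) ⟩
    1
      ∎
    where
    open ≡-Reasoning
    matches⇔u∈⁅v⁆ : ∀ u → Matches R (ιᵘ u) (ωᵘ u) y ⇔ u ∈ ⁅ v ⁆
    matches⇔u∈⁅v⁆ u = mk⇔
      (λ m → from x∈⁅y⁆⇔x≡y (sym (Fin.suc-injective (trans (sym y≡v) (proj₂ (to (Matches-extended R u y) m))))))
      (λ u∈⁅v⁆ → from (Matches-extended R u y) (match , trans y≡v (cong suc (sym (to x∈⁅y⁆⇔x≡y u∈⁅v⁆)))))
      where open Equivalence

module _ {n q₀ r s w lam : ℕ} {Y : List (Word n (suc q₀))} (design : IsDesign r s w lam Y) (s≤r : s ≤ r) where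

  mRS-fewerPrescribed : ∀ d {s′} → d + s′ ≡ s → (ι : Fin s′ → Fin n) (R : Subset n) (ω : Fin s′ → Fin (suc q₀)) →
    StrictlyIncreasing ι → ImageIn ι R → ∣ R ∣ ≡ r → (∀ j → Nonzero (ω j)) → mRS Y R ι ω ≡ q₀ ^ d * lam
  mRS-fewerPrescribed zero refl ι R ω ι↑ ι⊆R ∣R∣≡r ω≢0 =
    trans (design ι R ω ι↑ ι⊆R ∣R∣≡r ω≢0) (sym (ℕ.+-identityʳ lam))
  mRS-fewerPrescribed (suc d) {s′} d+s′≡s ι R ω ι↑ ι⊆R ∣R∣≡r ω≢0
    with a , a∈R , ι≢a ← ∃-outside-image ι R
           (ℕ.<-≤-trans (subst (s′ <_) d+s′≡s (ℕ.m<n+m s′ (s≤s z≤n))) (subst (s ≤_) (sym ∣R∣≡r) s≤r)) = begin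
    mRS Y R ι ω                                   ≡⟨ ℕ.*-identityʳ _ ⟨
    mRS Y R ι ω * 1                               ≡⟨ double-counting ⊥ (λ u → matches? R (ιᵘ u) (ωᵘ u)) (matches? R ι ω) 1 Y
                                                       (λ {y} _ → ∑∉⊥-𝟙Matches-extended a∈R y (matches? R ι ω y)) ⟨
    ∑∉ ⊥ (λ u → mRS Y R (ιᵘ u) (ωᵘ u))            ≡⟨ ∑∉-const ⊥ (λ {u} _ → IH u) ⟩
    (q₀ ∸ ∣ ⊥ {q₀} ∣) * (q₀ ^ d * lam)            ≡⟨ cong (λ k → (q₀ ∸ k) * (q₀ ^ d * lam)) (∣⊥∣≡0 q₀) ⟩
    q₀ * (q₀ ^ d * lam)                           ≡⟨ ℕ.*-assoc q₀ (q₀ ^ d) lam ⟨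
    q₀ ^ suc d * lam                              ∎
    where
    open ≡-Reasoning
    open Extension ι ω a
    IH : ∀ u → mRS Y R (ιᵘ u) (ωᵘ u) ≡ q₀ ^ d * lam
    IH u = mRS-fewerPrescribed d (trans (ℕ.+-suc d s′) d+s′≡s) (ιᵘ u) R (ωᵘ u)
      (strictlyIncreasing-insert _ (a , suc u) ι↑ ι≢a)
      (∀-insert⁺ (λ (i , _) → i ∈ R) _ a∈R ι⊆R)
      ∣R∣≡r
      (∀-insert⁺ (λ (_ , v) → Nonzero v) _ (λ ()) ω≢0)

module _ {n q s : ℕ} (ι : Fin s → Fin n) (ω : Fin s → Fin q) where

  ∑∉-𝟙Matches-insert : ∀ {w} (R : Subset n) (y : Word n q) → inX w y → (match? : Dec (Matches R ι ω y)) →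
    ∑∉ R (λ a → 𝟙 (matches? (R [ a ]≔ inside) ι ω y)) ≡ 𝟙 match? * (w ∸ ∣ R ∣)
  ∑∉-𝟙Matches-insert R y y∈X (no ¬match) =
    ∑∉-0 R (λ {a} _ → 𝟙-no (matches? (R [ a ]≔ inside) ι ω y) (¬match ∘ proj₁ ∘ Equivalence.to (Matches-insert R a)))
  ∑∉-𝟙Matches-insert {w} R y y∈X (yes match@(R⊆y , _)) = begin
    ∑∉ R (λ a → 𝟙 (matches? (R [ a ]≔ inside) ι ω y))
      ≡⟨ ∑∉-cong R (λ {a} _ → 𝟙-cong (matches? (R [ a ]≔ inside) ι ω y) (a ∈? support y) (matches⇔a∈y a)) ⟩
    ∑∉ R (λ a → 𝟙 (a ∈? support y))
      ≡⟨ ∑∉-𝟙∈ R⊆y ⟩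
    ∣ support y ∣ ∸ ∣ R ∣
      ≡⟨ cong (_∸ ∣ R ∣) y∈X ⟩
    w ∸ ∣ R ∣
      ≡⟨ ℕ.*-identityˡ _ ⟨
    1 * (w ∸ ∣ R ∣)
      ∎
    where
    open ≡-Reasoning
    matches⇔a∈y : ∀ a → Matches (R [ a ]≔ inside) ι ω y ⇔ a ∈ support y
    matches⇔a∈y a = mk⇔ (proj₂ ∘ Equivalence.to (Matches-insert R a)) (Equivalence.from (Matches-insert R a) ∘ (match ,_))

  ∑∉-mRS-insert : ∀ {w} (Y : List (Word n q)) → All (inX w) Y → (R : Subset n) →
    ∑∉ R (λ a → mRS Y (R [ a ]≔ inside) ι ω) ≡ mRS Y R ι ω * (w ∸ ∣ R ∣)
  ∑∉-mRS-insert {w} Y Y⊆X R = double-counting R (λ a → matches? (R [ a ]≔ inside) ι ω) (matches? R ι ω) (w ∸ ∣ R ∣) Y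
    (λ {y} y∈Y → ∑∉-𝟙Matches-insert R y (All.lookup Y⊆X y∈Y) (matches? R ι ω y))

  𝟙MatchesAvoid-remove : ∀ (R T : Subset n) {a} → a ∈ T → (y : Word n q) →
    𝟙 (matchesAvoid? R ι ω (T [ a ]≔ outside) y)
      ≡ 𝟙 (matchesAvoid? R ι ω T y) + 𝟙 (matchesAvoid? (R [ a ]≔ inside) ι ω (T [ a ]≔ outside) y)
  𝟙MatchesAvoid-remove R T {a} a∈T y with a ∈? support y
  ... | yes a∈y = cong₂ _+_
        (sym (𝟙-no (matchesAvoid? R ι ω T y) λ (_ , T∩y≡⊥) → p∩q≡⊥⇒x∈p⇒x∉q T∩y≡⊥ a∈T a∈y))
        (𝟙-cong (matchesAvoid? R ι ω (T [ a ]≔ outside) y) (matchesAvoid? (R [ a ]≔ inside) ι ω (T [ a ]≔ outside) y)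
          (mk⇔ (λ (match , avoid) → Equivalence.from (Matches-insert R a) (match , a∈y) , avoid)
               (λ (match⁺ , avoid) → proj₁ (Equivalence.to (Matches-insert R a) match⁺) , avoid)))
  ... | no a∉y = trans
        (𝟙-cong (matchesAvoid? R ι ω (T [ a ]≔ outside) y) (matchesAvoid? R ι ω T y)
          (mk⇔ (λ (match , avoid) → match , Equivalence.to avoid⇔ avoid)
               (λ (match , avoid) → match , Equivalence.from avoid⇔ avoid)))
        (sym (trans (cong (𝟙 (matchesAvoid? R ι ω T y) +_)
          (𝟙-no (matchesAvoid? (R [ a ]≔ inside) ι ω (T [ a ]≔ outside) y)
            (a∉y ∘ proj₂ ∘ Equivalence.to (Matches-insert R a) ∘ proj₁)))
          (ℕ.+-identityʳ _)))
        where
        avoid⇔ : (T [ a ]≔ outside) ∩ support y ≡ ⊥ ⇔ T ∩ support y ≡ ⊥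
        avoid⇔ = p[x]≔outside∩q≡⊥⇔p∩q≡⊥ T (support y) a∉y

  mRST-remove : ∀ (Y : List (Word n q)) (R T : Subset n) {a} → a ∈ T →
    mRST Y R ι ω (T [ a ]≔ outside) ≡ mRST Y R ι ω T + mRST Y (R [ a ]≔ inside) ι ω (T [ a ]≔ outside)
  mRST-remove Y R T a∈T = length-filter-+ (matchesAvoid? R ι ω _) (matchesAvoid? R ι ω T) _ Y
    (𝟙MatchesAvoid-remove R T a∈T)

module Regular {n q w r s μ : ℕ} {Y : List (Word n q)} (Y⊆X : All (inX w) Y) (ι : Fin s → Fin n) (ω : Fin s → Fin q)
  (regular : ∀ R → ImageIn ι R → ∣ R ∣ ≡ r → mRS Y R ι ω ≡ μ) (r≤w : r ≤ w) (w≤n : w ≤ n) where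

  Cᵣ : ℕ
  Cᵣ = (n ∸ r) C (w ∸ r)

  ImageIn-insert : ∀ {R} a → ImageIn ι R → ImageIn ι (R [ a ]≔ inside)
  ImageIn-insert {R} a ι⊆R = ∈-insert⁺ R ∘ ι⊆R

  mRS-fewerRequired : ∀ e (R : Subset n) → e + ∣ R ∣ ≡ r → ImageIn ι R →
    mRS Y R ι ω * Cᵣ ≡ ((n ∸ ∣ R ∣) C (w ∸ ∣ R ∣)) * μ
  mRS-fewerRequired zero R refl ι⊆R = trans (cong (_* Cᵣ) (regular R ι⊆R refl)) (ℕ.*-comm μ Cᵣ)
  mRS-fewerRequired (suc e) R e+∣R∣≡r ι⊆R = ℕ.*-cancelˡ-≡ _ _ (suc W) (begin
    suc W * (mRS Y R ι ω * Cᵣ)                         ≡⟨ x∙yz≈y∙xz (suc W) (mRS Y R ι ω) Cᵣ ⟩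
    mRS Y R ι ω * (suc W * Cᵣ)                         ≡⟨ ℕ.*-assoc (mRS Y R ι ω) (suc W) Cᵣ ⟨
    mRS Y R ι ω * suc W * Cᵣ                           ≡⟨ cong (λ k → mRS Y R ι ω * k * Cᵣ) w∸∣R∣≡1+W ⟨
    mRS Y R ι ω * (w ∸ ∣ R ∣) * Cᵣ                     ≡⟨ cong (_* Cᵣ) (∑∉-mRS-insert ι ω Y Y⊆X R) ⟨
    ∑∉ R (λ a → mRS Y (R [ a ]≔ inside) ι ω) * Cᵣ      ≡⟨ ∑∉-*ʳ R _ Cᵣ ⟨
    ∑∉ R (λ a → mRS Y (R [ a ]≔ inside) ι ω * Cᵣ)      ≡⟨ ∑∉-const R IH ⟩
    (n ∸ ∣ R ∣) * ((N C W) * μ)                          ≡⟨ cong (λ k → k * ((N C W) * μ)) n∸∣R∣≡1+N ⟩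
    suc N * ((N C W) * μ)                                ≡⟨ ℕ.*-assoc (suc N) (N C W) μ ⟨
    suc N * (N C W) * μ                                ≡⟨ cong (_* μ) ([1+n]*nCk≡[1+k]*[1+n]C[1+k] N W) ⟩
    suc W * (suc N C suc W) * μ                        ≡⟨ ℕ.*-assoc (suc W) (suc N C suc W) μ ⟩
    suc W * ((suc N C suc W) * μ)                        ≡⟨ cong₂ (λ k l → suc W * ((k C l) * μ)) n∸∣R∣≡1+N w∸∣R∣≡1+W ⟨
    suc W * (((n ∸ ∣ R ∣) C (w ∸ ∣ R ∣)) * μ)             ∎)
    where
    open ≡-Reasoning
    N W : ℕ
    N = n ∸ suc ∣ R ∣
    W = w ∸ suc ∣ R ∣
    ∣R∣<w : ∣ R ∣ < w
    ∣R∣<w = ℕ.<-≤-trans (subst (∣ R ∣ <_) e+∣R∣≡r (ℕ.m<n+m ∣ R ∣ (s≤s z≤n))) r≤w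
    w∸∣R∣≡1+W : w ∸ ∣ R ∣ ≡ suc W
    w∸∣R∣≡1+W = ℕ.+-∸-assoc 1 ∣R∣<w
    n∸∣R∣≡1+N : n ∸ ∣ R ∣ ≡ suc N
    n∸∣R∣≡1+N = ℕ.+-∸-assoc 1 (ℕ.<-≤-trans ∣R∣<w w≤n)
    IH : ∀ {a} → a ∉ R → mRS Y (R [ a ]≔ inside) ι ω * Cᵣ ≡ (N C W) * μ
    IH {a} a∉R = subst (λ k → mRS Y (R [ a ]≔ inside) ι ω * Cᵣ ≡ ((n ∸ k) C (w ∸ k)) * μ) ∣R⁺∣≡1+∣R∣
      (mRS-fewerRequired e (R [ a ]≔ inside) (trans (cong (e +_) ∣R⁺∣≡1+∣R∣) (trans (ℕ.+-suc e ∣ R ∣) e+∣R∣≡r))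
        (ImageIn-insert a ι⊆R))
      where
      ∣R⁺∣≡1+∣R∣ : ∣ R [ a ]≔ inside ∣ ≡ suc ∣ R ∣
      ∣R⁺∣≡1+∣R∣ = ∣p[x]≔inside∣≡1+∣p∣ R a∉R

  mRST-avoiding : ∀ t (R T : Subset n) → ∣ T ∣ ≡ t → t + ∣ R ∣ ≤ r → ImageIn ι R → R ∩ T ≡ ⊥ →
    mRST Y R ι ω T * Cᵣ ≡ ((n ∸ ∣ R ∣ ∸ t) C (w ∸ ∣ R ∣)) * μ
  mRST-avoiding zero R T ∣T∣≡0 ∣R∣≤r ι⊆R _ =
    trans (cong (_* Cᵣ) mRST≡mRS) (mRS-fewerRequired (r ∸ ∣ R ∣) R (ℕ.m∸n+n≡m ∣R∣≤r) ι⊆R)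
    where
    mRST≡mRS : mRST Y R ι ω T ≡ mRS Y R ι ω
    mRST≡mRS = length-filter-cong (matchesAvoid? R ι ω T) (matches? R ι ω) Y
      (λ y → mk⇔ proj₁ (λ match → match , x∈p⇒x∉q⇒p∩q≡⊥ (λ x∈T _ → ∣p∣≡0⇒x∉p ∣T∣≡0 x∈T)))
  mRST-avoiding (suc t) R T ∣T∣≡1+t 1+t+∣R∣≤r ι⊆R R∩T≡⊥ with a , a∈T ← ∣p∣≡1+n⇒Nonempty ∣T∣≡1+t =
    ℕ.+-cancelʳ-≡ ((M C W) * μ) _ _ (begin
    mRST Y R ι ω T * Cᵣ + (M C W) * μ                      ≡⟨ cong (mRST Y R ι ω T * Cᵣ +_) IH⁺ ⟨
    mRST Y R ι ω T * Cᵣ + mRST Y R⁺ ι ω T⁻ * Cᵣ            ≡⟨ ℕ.*-distribʳ-+ Cᵣ (mRST Y R ι ω T) _ ⟨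
    (mRST Y R ι ω T + mRST Y R⁺ ι ω T⁻) * Cᵣ               ≡⟨ cong (_* Cᵣ) (mRST-remove ι ω Y R T a∈T) ⟨
    mRST Y R ι ω T⁻ * Cᵣ                                   ≡⟨ IH ⟩
    ((n ∸ ∣ R ∣ ∸ t) C (w ∸ ∣ R ∣)) * μ                     ≡⟨ cong₂ (λ k l → (k C l) * μ) n∸∣R∣∸t≡1+M w∸∣R∣≡1+W ⟩
    (suc M C suc W) * μ                                    ≡⟨ cong (_* μ) (nCk+nC[k+1]≡[n+1]C[k+1] M W) ⟨
    (M C W + M C suc W) * μ                                ≡⟨ ℕ.*-distribʳ-+ μ (M C W) (M C suc W) ⟩
    (M C W) * μ + (M C suc W) * μ                          ≡⟨ ℕ.+-comm ((M C W) * μ) _ ⟩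
    (M C suc W) * μ + (M C W) * μ                          ≡⟨ cong (λ l → (M C l) * μ + (M C W) * μ) w∸∣R∣≡1+W ⟨
    ((n ∸ ∣ R ∣ ∸ suc t) C (w ∸ ∣ R ∣)) * μ + (M C W) * μ  ∎)
    where
    open ≡-Reasoning
    R⁺ T⁻ : Subset n
    R⁺ = R [ a ]≔ inside
    T⁻ = T [ a ]≔ outside
    M W : ℕ
    M = n ∸ ∣ R ∣ ∸ suc t
    W = w ∸ suc ∣ R ∣
    t+1+∣R∣≤r : t + suc ∣ R ∣ ≤ r
    t+1+∣R∣≤r = subst (_≤ r) (sym (ℕ.+-suc t ∣ R ∣)) 1+t+∣R∣≤r
    w∸∣R∣≡1+W : w ∸ ∣ R ∣ ≡ suc W
    w∸∣R∣≡1+W = ℕ.+-∸-assoc 1 (ℕ.≤-trans (ℕ.m+n≤o⇒n≤o t t+1+∣R∣≤r) r≤w)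
    n∸∣R∣∸t≡1+M : n ∸ ∣ R ∣ ∸ t ≡ suc M
    n∸∣R∣∸t≡1+M = ℕ.+-∸-assoc 1 (ℕ.m+n≤o⇒m≤o∸n (suc t) (ℕ.≤-trans 1+t+∣R∣≤r (ℕ.≤-trans r≤w w≤n)))
    a∉R : a ∉ R
    a∉R a∈R = p∩q≡⊥⇒x∈p⇒x∉q R∩T≡⊥ a∈R a∈T
    ∣T⁻∣≡t : ∣ T⁻ ∣ ≡ t
    ∣T⁻∣≡t = ℕ.suc-injective (trans (1+∣p[x]≔outside∣≡∣p∣ T a∈T) ∣T∣≡1+t)
    IH : mRST Y R ι ω T⁻ * Cᵣ ≡ ((n ∸ ∣ R ∣ ∸ t) C (w ∸ ∣ R ∣)) * μ
    IH = mRST-avoiding t R T⁻ ∣T⁻∣≡t (ℕ.≤-trans (ℕ.+-monoʳ-≤ t (ℕ.n≤1+n ∣ R ∣)) t+1+∣R∣≤r) ι⊆R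
      (p∩q≡⊥⇒p∩q[x]≔outside≡⊥ T R∩T≡⊥)
    IH⁺ : mRST Y R⁺ ι ω T⁻ * Cᵣ ≡ (M C W) * μ
    IH⁺ = subst₂ (λ k l → mRST Y R⁺ ι ω T⁻ * Cᵣ ≡ (k C l) * μ)
      (trans (cong (λ k → n ∸ k ∸ t) ∣R⁺∣≡1+∣R∣) (m∸[1+n]∸o≡m∸n∸[1+o] n ∣ R ∣ t)) (cong (w ∸_) ∣R⁺∣≡1+∣R∣)
      (mRST-avoiding t R⁺ T⁻ ∣T⁻∣≡t (subst (λ k → t + k ≤ r) (sym ∣R⁺∣≡1+∣R∣) t+1+∣R∣≤r) (ImageIn-insert a ι⊆R)
        (p∩q≡⊥⇒p[x]≔inside∩q[x]≔outside≡⊥ R T R∩T≡⊥))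
      where
      ∣R⁺∣≡1+∣R∣ : ∣ R [ a ]≔ inside ∣ ≡ suc ∣ R ∣
      ∣R⁺∣≡1+∣R∣ = ∣p[x]≔inside∣≡1+∣p∣ R a∉R

-- Counts are taken with multiplicity.
proposition4p5 : ∀ (q n w r s lam : ℕ) → 2 ≤ q → 1 ≤ n → w ≤ n → s ≤ r → r ≤ w →
    (Y : List (Word n q)) → Unique Y → All (inX w) Y →
    IsDesign r s w lam Y →
    ∀ (s′ r′ t : ℕ) → s′ ≤ s → s′ ≤ r′ → r′ ≤ r → t ≤ r ∸ r′ →
    ∀ (ι′ : Fin s′ → Fin n) (R′ T : Subset n) (ω′ : Fin s′ → Fin q) →
    StrictlyIncreasing ι′ → ImageIn ι′ R′ → ∣ R′ ∣ ≡ r′ → ∣ T ∣ ≡ t → R′ ∩ T ≡ ⊥ →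
    (∀ j → Nonzero (ω′ j)) →
    mRST Y R′ ι′ ω′ T * ((n ∸ r) C (w ∸ r))
    ≡ (q ∸ 1) ^ (s ∸ s′) * ((n ∸ r′ ∸ t) C (w ∸ r′)) * lam
proposition4p5 q n w r s lam (s≤s (s≤s {n = q₁} _)) _ w≤n s≤r r≤w Y _ Y⊆X design
  s′ r′ t s′≤s _ r′≤r t≤r∸r′ ι′ R′ T ω′ ι′↑ ι′⊆R′ refl refl R′∩T≡⊥ ω′≢0 = begin
  mRST Y R′ ι′ ω′ T * ((n ∸ r) C (w ∸ r))
    ≡⟨ mRST-avoiding t R′ T refl (ℕ.m≤o∸n⇒m+n≤o t r′≤r t≤r∸r′) ι′⊆R′ R′∩T≡⊥ ⟩
  ((n ∸ r′ ∸ t) C (w ∸ r′)) * (K * lam)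
    ≡⟨ x∙yz≈y∙xz ((n ∸ r′ ∸ t) C (w ∸ r′)) K lam ⟩
  K * (((n ∸ r′ ∸ t) C (w ∸ r′)) * lam)
    ≡⟨ ℕ.*-assoc K ((n ∸ r′ ∸ t) C (w ∸ r′)) lam ⟨
  K * ((n ∸ r′ ∸ t) C (w ∸ r′)) * lam
    ∎
  where
  open ≡-Reasoning
  K = suc q₁ ^ (s ∸ s′)
  regular : ∀ R → ImageIn ι′ R → ∣ R ∣ ≡ r → mRS Y R ι′ ω′ ≡ K * lam
  regular R ι′⊆R ∣R∣≡r =
    mRS-fewerPrescribed {w = w} {Y = Y} design s≤r (s ∸ s′) (ℕ.m∸n+n≡m s′≤s) ι′ R ω′ ι′↑ ι′⊆R ∣R∣≡r ω′≢0
  open Regular Y⊆X ι′ ω′ regular r≤w w≤n
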